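{- For integers $n\ge 1$, $k\ge 1$ and $0\le r\le k-1$, there is a bijection between $\mathcal{L}_{n,k;r}(12\cdots(k+1))$ and the set of standard Young tableaux of shape $\langle k^n, r\rangle$.
   Context: A word $w$ contains a pattern $p\in S_m$ if some subsequence of $w$ of length $m$ is order-isomorphic to $p$; otherwise $w$ avoids $p$; $S(p)$ is the set of elements of $S$ avoiding $p$. For $k\ge1$ and $0\le r\le k-1$, $\mathcal{L}_{n,k;r}$ is the set of permutations $w=w_{0,2}w_{0,3}\cdots w_{0,r+1}w_{1,1}\cdots w_{1,k}w_{2,1}\cdots w_{n,k}\in S_{nk+r}$ (an initial block of length $r$ followed by $n$ blocks of length $k$) satisfying (L1$'$) $w_{i,j}<w_{i,j+1}$ whenever $1\le i\le n$, $1\le j\le k-1$, or $i=0$, $2\le j\le r$; and (L2$'$) $w_{i,j+1}>w_{i+1,j}$ whenever $1\le i\le n-1$, $1\le j\le k-1$, or $i=0$, $1\le j\le r$. $\langle k^n,r\rangle$ is the partition with $n$ parts equal to $k$ followed by one part equal to $r$. -}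

module Defs where

open import Data.Nat using (ℕ; zero; suc; _+_; _*_; _∸_; _≤_; _<_)
open import Data.List using (List; []; _∷_; length; map; upTo; concat; replicate; _++_)
open import Data.Nat.ListAction using (sum)
open import Data.List.Relation.Binary.Sublist.Propositional using (_⊆_)
open import Data.List.Relation.Binary.Permutation.Propositional using (_↭_)
open import Data.Product using (Σ; ∃; _×_; proj₁)
open import Relation.Nullary using (¬_)
open import Relation.Binary.PropositionalEquality using (_≡_)
open import Function.Bundles using (_⇔_)

-- Safe indexing into a list (0-based); out-of-range gives 0.
-- All uses below are guarded by range hypotheses.
_!_ : List ℕ → ℕ → ℕ
[]       ! _     = 0
(x ∷ xs) ! zero  = x
(x ∷ xs) ! suc i = xs ! i

oneTo : ℕ → List ℕ
oneTo N = map suc (upTo N)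

-- w is a permutation in S_N (one-line notation, values 1..N)
IsPerm : ℕ → List ℕ → Set
IsPerm N w = w ↭ oneTo N

OrderIso : List ℕ → List ℕ → Set
OrderIso u v = (length u ≡ length v) ×
  (∀ i j → i < length u → j < length u → ((u ! i < u ! j) ⇔ (v ! i < v ! j)))

Contains : List ℕ → List ℕ → Set
Contains w p = ∃ λ s → (s ⊆ w) × OrderIso s p

Avoids : List ℕ → List ℕ → Set
Avoids w p = ¬ Contains w p

idPat : ℕ → List ℕ
idPat m = oneTo m

-- Position (0-based) of w_{i,j} in w = w_{0,2}..w_{0,r+1} w_{1,1}..w_{1,k} ... w_{n,k}
pos : (k r : ℕ) → ℕ → ℕ → ℕ
pos k r zero    j = j ∸ 2
pos k r (suc i) j = r + i * k + (j ∸ 1)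

entry : (k r : ℕ) → List ℕ → ℕ → ℕ → ℕ
entry k r w i j = w ! pos k r i j

InL : (n k r : ℕ) → List ℕ → Set
InL n k r w =
  IsPerm (n * k + r) w ×
  ((∀ i j → 1 ≤ i → i ≤ n → 1 ≤ j → j ≤ k ∸ 1 → entry k r w i j < entry k r w i (suc j)) ×
   (∀ j → 2 ≤ j → j ≤ r → entry k r w 0 j < entry k r w 0 (suc j))) ×
  ((∀ i j → 1 ≤ i → i ≤ n ∸ 1 → 1 ≤ j → j ≤ k ∸ 1 →
       entry k r w (suc i) j < entry k r w i (suc j)) ×
   (∀ j → 1 ≤ j → j ≤ r → entry k r w 1 j < entry k r w 0 (suc j)))

InLAvoid : (n k r : ℕ) → List ℕ → Set
InLAvoid n k r w = InL n k r w × Avoids w (idPat (suc k))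

-- Standard Young tableaux of shape λ (λ given as list of row lengths),
-- represented as the list of rows (English notation, rows 0-based).
rowAt : List (List ℕ) → ℕ → List ℕ
rowAt []       _       = []
rowAt (x ∷ xs) zero    = x
rowAt (x ∷ xs) (suc i) = rowAt xs i

IsSYT : List ℕ → List (List ℕ) → Set
IsSYT λs T =
  (map length T ≡ λs) ×
  (concat T ↭ oneTo (sum λs)) ×
  (∀ a b → suc b < length (rowAt T a) → rowAt T a ! b < rowAt T a ! suc b) ×
  (∀ a b → b < length (rowAt T (suc a)) → rowAt T a ! b < rowAt T (suc a) ! b)

shape : ℕ → ℕ → ℕ → List ℕ
shape n k r = replicate n k ++ (r ∷ [])

-- A bijection between the subsets {x | P x} ⊆ A and {y | Q y} ⊆ B
-- (maps depend only on the underlying elements, and are mutually inverse).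
record SubsetBij {A B : Set} (P : A → Set) (Q : B → Set) : Set where
  field
    to      : Σ A P → Σ B Q
    from    : Σ B Q → Σ A P
    to-cong   : ∀ x x′ → proj₁ x ≡ proj₁ x′ → proj₁ (to x) ≡ proj₁ (to x′)
    from-cong : ∀ y y′ → proj₁ y ≡ proj₁ y′ → proj₁ (from y) ≡ proj₁ (from y′)
    from∘to : ∀ x → proj₁ (from (to x)) ≡ proj₁ x
    to∘from : ∀ y → proj₁ (to (from y)) ≡ proj₁ y

-- Cut w ∈ S_{nk+r} into its blocks G = B₀ B₁ ⋯ Bₙ (|B₀| = r, |Bᵢ| = k) and
-- stack them bottom-up: the tableau is T = Bₙ ⋯ B₁ B₀, i.e. the reversed
-- block list, and the inverse map concatenates the rows of T bottom-up.
-- These list operations are mutually inverse on lists of the right shape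
-- (`chunks-concat`, `concat-chunks`), so everything reduces to showing that
-- w satisfies the defining conditions iff its blocks increase along rows
-- (this is (L1')) and each block lies entrywise below its predecessor:
--  * avoidance ⇒ columns: if B_{i+1}[b] > Bᵢ[b] then Bᵢ[0..b] B_{i+1}[b..]
--    is an increasing subsequence of length k+1 (`below-of-avoiding`);
--  * columns ⇒ avoidance: label each entry by its column; along an increasing
--    subsequence of the row word of such an array the labels strictly
--    increase, so its length is at most k (`increasing-subsequence-bound`);
--    B₁ below B₀ is part of (L2'), and the rest of (L2') is a column step
--    followed by a step along a row.
module Submission where

open import Defs
open import Data.Nat using (ℕ; zero; suc; _+_; _*_; _∸_; _≤_; _<_; z≤n; s≤s; _<?_)
open import Data.Nat.Properties
open import Data.List using (List; []; _∷_; length; map; upTo; applyUpTo; concat; replicate; _++_; take; drop; reverse; last; head)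
import Data.List.Properties as LP
open import Data.Nat.ListAction using (sum)
open import Data.Nat.ListAction.Properties using (sum-++)
open import Data.Product using (Σ; _×_; _,_; proj₁; proj₂)
open import Function using (_on_)
open import Data.Empty using (⊥-elim)
open import Relation.Nullary using (yes; no)
open import Relation.Binary.Definitions using (tri<; tri≈; tri>)
open import Relation.Binary.PropositionalEquality
open import Function.Bundles using (_⇔_; mk⇔; Equivalence)
open import Data.List.Relation.Unary.Linked using (Linked; []; [-]; _∷_; tail)
import Data.List.Relation.Unary.Linked.Properties as Linked
open import Data.List.Relation.Unary.AllPairs using (AllPairs; []; _∷_)
import Data.List.Relation.Unary.AllPairs.Properties as AllPairs
open import Data.List.Relation.Unary.All using (All; []; _∷_)
import Data.List.Relation.Unary.All as All
import Data.List.Relation.Unary.All.Properties as All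
open import Data.List.Relation.Unary.Unique.Propositional using (Unique)
import Data.List.Relation.Unary.Unique.Propositional.Properties as Unique
open import Data.List.Relation.Binary.Sublist.Propositional using (_⊆_; ⊆-refl; ⊆-trans; []; _∷ʳ_; _∷_)
import Data.List.Relation.Binary.Sublist.Propositional.Properties as Sublist
open import Data.List.Relation.Binary.Permutation.Propositional using (_↭_; ↭-sym; ↭-reflexive; ↭-refl; ↭-trans; ↭⇒↭ₛ)
import Data.List.Relation.Binary.Permutation.Propositional.Properties as Perm
import Data.List.Relation.Binary.Permutation.Setoid.Properties as PermSetoid
open import Data.Maybe using (just)
open import Data.Maybe.Relation.Binary.Connected using (Connected; just)

!-++ˡ : ∀ (xs ys : List ℕ) m → m < length xs → (xs ++ ys) ! m ≡ xs ! m
!-++ˡ (x ∷ xs) ys zero    _       = refl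
!-++ˡ (x ∷ xs) ys (suc m) (s≤s p) = !-++ˡ xs ys m p

!-++ʳ : ∀ (xs ys : List ℕ) m → (xs ++ ys) ! (length xs + m) ≡ ys ! m
!-++ʳ []       ys m = refl
!-++ʳ (x ∷ xs) ys m = !-++ʳ xs ys m

!-applyUpTo : ∀ (f : ℕ → ℕ) N i → i < N → map suc (applyUpTo f N) ! i ≡ suc (f i)
!-applyUpTo f (suc N) zero    _       = refl
!-applyUpTo f (suc N) (suc i) (s≤s p) = !-applyUpTo (λ x → f (suc x)) N i p

!-oneTo : ∀ N i → i < N → oneTo N ! i ≡ suc i
!-oneTo N = !-applyUpTo (λ x → x) N

length-oneTo : ∀ N → length (oneTo N) ≡ N
length-oneTo N = trans (LP.length-map suc (upTo N)) (LP.length-applyUpTo (λ x → x) N)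

length-take≤ : ∀ n (xs : List ℕ) → n ≤ length xs → length (take n xs) ≡ n
length-take≤ n xs p = trans (LP.length-take n xs) (m≤n⇒m⊓n≡m p)

take-length-++ : ∀ (xs ys : List ℕ) → take (length xs) (xs ++ ys) ≡ xs
take-length-++ []       ys = refl
take-length-++ (x ∷ xs) ys = cong (x ∷_) (take-length-++ xs ys)

drop-length-++ : ∀ (xs ys : List ℕ) → drop (length xs) (xs ++ ys) ≡ ys
drop-length-++ []       ys = refl
drop-length-++ (x ∷ xs) ys = drop-length-++ xs ys

blocks : ℕ → ℕ → List ℕ → List (List ℕ)
blocks k zero    xs = []
blocks k (suc n) xs = take k xs ∷ blocks k n (drop k xs)

chunks : ℕ → ℕ → ℕ → List ℕ → List (List ℕ)
chunks n k r w = take r w ∷ blocks k n (drop r w)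

length-drop-exact : ∀ a b (xs : List ℕ) → length xs ≡ a + b → length (drop a xs) ≡ b
length-drop-exact a b xs p = trans (LP.length-drop a xs) (trans (cong (_∸ a) p) (m+n∸m≡n a b))

concat-blocks : ∀ k n (xs : List ℕ) → length xs ≡ n * k → concat (blocks k n xs) ≡ xs
concat-blocks k zero    []  _ = refl
concat-blocks k (suc n) xs  p =
  trans (cong (take k xs ++_) (concat-blocks k n (drop k xs) (length-drop-exact k (n * k) xs p)))
        (LP.take++drop≡id k xs)

concat-chunks : ∀ n k r (w : List ℕ) → length w ≡ n * k + r → concat (chunks n k r w) ≡ w
concat-chunks n k r w p =
  trans (cong (take r w ++_) (concat-blocks k n (drop r w)
          (length-drop-exact r (n * k) w (trans p (+-comm (n * k) r)))))
        (LP.take++drop≡id r w)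

lengths-blocks : ∀ k n (xs : List ℕ) → length xs ≡ n * k → map length (blocks k n xs) ≡ replicate n k
lengths-blocks k zero    xs p = refl
lengths-blocks k (suc n) xs p =
  cong₂ _∷_ (length-take≤ k xs (subst (k ≤_) (sym p) (m≤m+n k (n * k))))
            (lengths-blocks k n (drop k xs) (length-drop-exact k (n * k) xs p))

lengths-chunks : ∀ n k r (w : List ℕ) → length w ≡ n * k + r → map length (chunks n k r w) ≡ r ∷ replicate n k
lengths-chunks n k r w p =
  cong₂ _∷_ (length-take≤ r w (subst (r ≤_) (sym p) (m≤n+m r (n * k))))
            (lengths-blocks k n (drop r w) (length-drop-exact r (n * k) w (trans p (+-comm (n * k) r))))

blocks-concat : ∀ k n (Bs : List (List ℕ)) → map length Bs ≡ replicate n k → blocks k n (concat Bs) ≡ Bs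
blocks-concat k zero    []       _ = refl
blocks-concat k (suc n) (B ∷ Bs) p with LP.∷-injective p
... | refl , q = cong₂ _∷_ (take-length-++ B (concat Bs))
                   (trans (cong (blocks (length B) n) (drop-length-++ B (concat Bs))) (blocks-concat (length B) n Bs q))

chunks-concat : ∀ n k r (G : List (List ℕ)) → map length G ≡ r ∷ replicate n k → chunks n k r (concat G) ≡ G
chunks-concat n k r (B ∷ Bs) p with LP.∷-injective p
... | refl , q = cong₂ _∷_ (take-length-++ B (concat Bs))
                   (trans (cong (blocks k n) (drop-length-++ B (concat Bs))) (blocks-concat k n Bs q))

∸-suc : ∀ m a → a < m → m ∸ a ≡ suc (m ∸ suc a)
∸-suc (suc m) zero    _       = refl
∸-suc (suc m) (suc a) (s≤s p) = ∸-suc m a p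

∸-suc-< : ∀ m a → 0 < m → m ∸ suc a < m
∸-suc-< (suc m) a _ = s≤s (m∸n≤m m a)

rowAt-beyond : ∀ (G : List (List ℕ)) a → length G ≤ a → rowAt G a ≡ []
rowAt-beyond []      a       _       = refl
rowAt-beyond (B ∷ G) (suc a) (s≤s p) = rowAt-beyond G a p

rowAt-++ˡ : ∀ (xs ys : List (List ℕ)) a → a < length xs → rowAt (xs ++ ys) a ≡ rowAt xs a
rowAt-++ˡ (x ∷ xs) ys zero    _       = refl
rowAt-++ˡ (x ∷ xs) ys (suc a) (s≤s p) = rowAt-++ˡ xs ys a p

rowAt-snoc : ∀ (xs : List (List ℕ)) B → rowAt (xs ++ B ∷ []) (length xs) ≡ B
rowAt-snoc []       B = refl
rowAt-snoc (x ∷ xs) B = rowAt-snoc xs B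

rowAt-reverse : ∀ (G : List (List ℕ)) a → a < length G → rowAt (reverse G) a ≡ rowAt G (length G ∸ suc a)
rowAt-reverse (B ∷ G) a p rewrite LP.unfold-reverse B G with <-cmp a (length G)
... | tri< a<m _ _ =
  trans (rowAt-++ˡ (reverse G) (B ∷ []) a (subst (a <_) (sym (LP.length-reverse G)) a<m))
        (trans (rowAt-reverse G a a<m) (cong (rowAt (B ∷ G)) (sym (∸-suc (length G) a a<m))))
... | tri≈ _ refl _ =
  trans (subst (λ z → rowAt (reverse G ++ B ∷ []) z ≡ B) (LP.length-reverse G) (rowAt-snoc (reverse G) B))
        (cong (rowAt (B ∷ G)) (sym (n∸n≡0 (length G))))
... | tri> _ _ a>m = ⊥-elim (<-irrefl refl (≤-trans p a>m))

rowAt-reverse-beyond : ∀ (G : List (List ℕ)) a → length G ≤ a → rowAt (reverse G) a ≡ []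
rowAt-reverse-beyond G a p = rowAt-beyond (reverse G) a (subst (_≤ a) (sym (LP.length-reverse G)) p)

all-rows-reverse : (P : List ℕ → Set) → P [] → (G : List (List ℕ)) →
                   (∀ i → P (rowAt G i)) → ∀ a → P (rowAt (reverse G) a)
all-rows-reverse P P[] G h a with a <? length G
... | yes p = subst P (sym (rowAt-reverse G a p)) (h _)
... | no ¬p = subst P (sym (rowAt-reverse-beyond G a (≮⇒≥ ¬p))) P[]

reverse-adjacent : ∀ (G : List (List ℕ)) a → suc a < length G →
                   rowAt (reverse G) (suc a) ≡ rowAt G (length G ∸ suc (suc a)) ×
                   rowAt (reverse G) a ≡ rowAt G (suc (length G ∸ suc (suc a)))
reverse-adjacent G a p =
  rowAt-reverse G (suc a) p ,
  trans (rowAt-reverse G a (≤-trans (n≤1+n (suc a)) p)) (cong (rowAt G) (∸-suc (length G) (suc a) p))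

adjacent-rows-reverse : (Q : List ℕ → List ℕ → Set) → (∀ x → Q x []) → (G : List (List ℕ)) →
                        (∀ i → suc i < length G → Q (rowAt G (suc i)) (rowAt G i)) →
                        ∀ a → Q (rowAt (reverse G) a) (rowAt (reverse G) (suc a))
adjacent-rows-reverse Q Q[] G h a with suc a <? length G
... | no ¬p = subst (Q _) (sym (rowAt-reverse-beyond G (suc a) (≮⇒≥ ¬p))) (Q[] _)
... | yes p with reverse-adjacent G a p
...   | e₁ , e₀ = subst₂ Q (sym e₀) (sym e₁) (h _ (subst (_< length G) (∸-suc (length G) (suc a) p)
                                                    (∸-suc-< (length G) a (≤-trans (s≤s z≤n) p))))

adjacent-rows-unreverse : (Q : List ℕ → List ℕ → Set) → (T : List (List ℕ)) →
                          (∀ a → Q (rowAt T a) (rowAt T (suc a))) →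
                          ∀ i → suc i < length T → Q (rowAt (reverse T) (suc i)) (rowAt (reverse T) i)
adjacent-rows-unreverse Q T h i p with reverse-adjacent T i p
... | e₁ , e₀ = subst₂ Q (sym e₁) (sym e₀) (h (length T ∸ suc (suc i)))

-- Increasing sequences.  `Increasing` is the indexed form used by tableaux;
-- `Linked _<_` is the structural form used to build subsequences.

Increasing : List ℕ → Set
Increasing B = ∀ b → suc b < length B → B ! b < B ! suc b

Increasing⇒Linked : ∀ B → Increasing B → Linked _<_ B
Increasing⇒Linked []          _ = []
Increasing⇒Linked (x ∷ [])    _ = [-]
Increasing⇒Linked (x ∷ y ∷ B) h = h 0 (s≤s (s≤s z≤n)) ∷ Increasing⇒Linked (y ∷ B) (λ b p → h (suc b) (s≤s p))

Linked-head-< : ∀ x xs → Linked _<_ (x ∷ xs) → ∀ j → j < length xs → x < xs ! j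
Linked-head-< x (y ∷ ys) (x<y ∷ l) zero    _       = x<y
Linked-head-< x (y ∷ ys) (x<y ∷ l) (suc j) (s≤s p) = <-trans x<y (Linked-head-< y ys l j p)

Linked-!-mono : ∀ s → Linked _<_ s → ∀ i j → i < j → j < length s → s ! i < s ! j
Linked-!-mono (x ∷ xs) l         zero    (suc j) _       (s≤s q) = Linked-head-< x xs l j q
Linked-!-mono (x ∷ xs) l         (suc i) (suc j) (s≤s p) (s≤s q) = Linked-!-mono xs (tail l) i j p q

Linked-!-mono≤ : ∀ C → Linked _<_ C → ∀ d c → d ≤ c → c < length C → C ! d ≤ C ! c
Linked-!-mono≤ C l d c d≤c p with <-cmp d c
... | tri< d<c _ _ = <⇒≤ (Linked-!-mono C l d c d<c p)
... | tri≈ _ refl _ = ≤-refl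
... | tri> _ _ c<d = ⊥-elim (<-irrefl refl (≤-<-trans d≤c c<d))

Linked⇒≅oneTo : ∀ s m → Linked _<_ s → length s ≡ m → OrderIso s (oneTo m)
Linked⇒≅oneTo s m l e = trans e (sym (length-oneTo m)) , λ i j p q →
  subst₂ (λ u v → (s ! i < s ! j) ⇔ (u < v))
    (sym (!-oneTo m i (subst (i <_) e p))) (sym (!-oneTo m j (subst (j <_) e q)))
    (mk⇔ (λ lt → s≤s (index-order lt p q)) (λ { (s≤s i<j) → Linked-!-mono s l i j i<j q }))
  where
  index-order : ∀ {i j} → s ! i < s ! j → i < length s → j < length s → i < j
  index-order {i} {j} lt p q with <-cmp i j
  ... | tri< i<j _ _ = i<j
  ... | tri≈ _ refl _ = ⊥-elim (<-irrefl refl lt)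
  ... | tri> _ _ j<i = ⊥-elim (<-asym lt (Linked-!-mono s l j i j<i p))

≅oneTo⇒Linked : ∀ s m → OrderIso s (oneTo m) → Linked _<_ s × length s ≡ m
≅oneTo⇒Linked s m (e , iso) = Increasing⇒Linked s increasing , e′
  where
  e′ : length s ≡ m
  e′ = trans e (length-oneTo m)
  increasing : Increasing s
  increasing b p = Equivalence.from (iso b (suc b) (≤-trans (n≤1+n (suc b)) p) p)
    (subst₂ _<_ (sym (!-oneTo m b (subst (b <_) e′ (≤-trans (n≤1+n (suc b)) p))))
                (sym (!-oneTo m (suc b) (subst (suc b <_) e′ p))) (n<1+n (suc b)))

Unique-perm : ∀ {N w} → IsPerm N w → Unique w
Unique-perm {N} p = PermSetoid.Unique-resp-↭ (setoid ℕ) (↭⇒↭ₛ (↭-sym p))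
                      (Unique.map⁺ suc-injective (Unique.upTo⁺ N))

AllPairs-⊆ : ∀ {A : Set} {R : A → A → Set} {xs ys : List A} → xs ⊆ ys → AllPairs R ys → AllPairs R xs
AllPairs-⊆ []         u       = u
AllPairs-⊆ (y ∷ʳ p)   (_ ∷ u) = AllPairs-⊆ p u
AllPairs-⊆ (refl ∷ p) (a ∷ u) = Sublist.All-resp-⊆ p a ∷ AllPairs-⊆ p u

All-! : ∀ {P : ℕ → Set} xs j → All P xs → j < length xs → P (xs ! j)
All-! (x ∷ xs) zero    (px ∷ _) _       = px
All-! (x ∷ xs) (suc j) (_ ∷ a)  (s≤s p) = All-! xs j a p

Unique-++-! : ∀ xs ys i j → Unique (xs ++ ys) → i < length xs → j < length ys → xs ! i ≢ ys ! j
Unique-++-! (x ∷ xs) ys zero    j (a ∷ _) _       q = All-! ys j (All.++⁻ʳ xs a) q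
Unique-++-! (x ∷ xs) ys (suc i) j (_ ∷ u) (s≤s p) q = Unique-++-! xs ys i j u p q

adjacent-rows-⊆ : ∀ (G : List (List ℕ)) i → rowAt G i ++ rowAt G (suc i) ⊆ concat G
adjacent-rows-⊆ []      i       = []
adjacent-rows-⊆ (B ∷ G) zero    = Sublist.++⁺ ⊆-refl (first-row G)
  where
  first-row : ∀ (G : List (List ℕ)) → rowAt G 0 ⊆ concat G
  first-row []      = []
  first-row (C ∷ G) = Sublist.++⁺ʳ (concat G) ⊆-refl
adjacent-rows-⊆ (B ∷ G) (suc i) = Sublist.++⁺ˡ B (adjacent-rows-⊆ G i)

splice-increasing : ∀ (B C : List ℕ) b → b < length B → b < length C →
                    Linked _<_ B → Linked _<_ C → B ! b < C ! b → Linked _<_ (take (suc b) B ++ drop b C)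
splice-increasing B C b b<|B| b<|C| lB lC rise =
  Linked.++⁺ (Linked.AllPairs⇒Linked (AllPairs.take⁺ (suc b) (Linked.Linked⇒AllPairs <-trans lB)))
             junction
             (Linked.AllPairs⇒Linked (AllPairs.drop⁺ b (Linked.Linked⇒AllPairs <-trans lC)))
  where
  last-take : ∀ b (B : List ℕ) → b < length B → last (take (suc b) B) ≡ just (B ! b)
  last-take zero    (x ∷ B)     _       = refl
  last-take (suc b) (x ∷ y ∷ B) (s≤s p) = last-take b (y ∷ B) p
  head-drop : ∀ b (C : List ℕ) → b < length C → head (drop b C) ≡ just (C ! b)
  head-drop zero    (x ∷ C) _       = refl
  head-drop (suc b) (x ∷ C) (s≤s p) = head-drop b C p
  junction : Connected _<_ (last (take (suc b) B)) (head (drop b C))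
  junction rewrite last-take b B b<|B| | head-drop b C b<|C| = just rise

length-splice : ∀ k (B C : List ℕ) b → length B ≡ k → length C ≡ k → b < k →
                length (take (suc b) B ++ drop b C) ≡ suc k
length-splice k B C b eB eC b<k =
  trans (LP.length-++ (take (suc b) B))
        (trans (cong₂ _+_ (length-take≤ (suc b) B (subst (suc b ≤_) (sym eB) b<k))
                          (trans (LP.length-drop b C) (cong (_∸ b) eC)))
               (cong suc (m+[n∸m]≡n (<⇒≤ b<k))))

-- Avoidance forces columns: if B and C are increasing rows of length k whose
-- juxtaposition B C is a sublist of a word avoiding 12⋯(k+1) with distinct
-- entries, then C lies entrywise below B (else splice them at column b).
below-of-avoiding : ∀ k (w B C : List ℕ) b → length B ≡ k → length C ≡ k →
                    Linked _<_ B → Linked _<_ C → b < k → B ++ C ⊆ w → Unique w →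
                    Avoids w (oneTo (suc k)) → C ! b < B ! b
below-of-avoiding k w B C b eB eC lB lC b<k sub u av with <-cmp (C ! b) (B ! b)
... | tri< lt _ _ = lt
... | tri≈ _ eq _ =
  ⊥-elim (Unique-++-! B C b b (AllPairs-⊆ sub u) (subst (b <_) (sym eB) b<k) (subst (b <_) (sym eC) b<k) (sym eq))
... | tri> _ _ gt =
  ⊥-elim (av (take (suc b) B ++ drop b C ,
              ⊆-trans (Sublist.++⁺ (Sublist.take-⊆ (suc b) B) (Sublist.drop-⊆ b C)) sub ,
              Linked⇒≅oneTo _ (suc k)
                (splice-increasing B C b (subst (b <_) (sym eB) b<k) (subst (b <_) (sym eC) b<k) lB lC gt)
                (length-splice k B C b eB eC b<k)))

-- Consider rows G = B₀ B₁ ⋯, each increasing, with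
-- each row at least as long as its predecessor and lying entrywise below it.
-- Labelling each entry of the row word concat G by its column, any earlier
-- entry smaller than a later one has a smaller column label; hence an
-- increasing subsequence uses distinct columns and is no longer than the
-- longest row.

Below : List ℕ → List ℕ → Set
Below C B = ∀ b → b < length B → C ! b < B ! b

-- C may be placed directly under B in a (reversed) Young-diagram array.
Stacked : List ℕ → List ℕ → Set
Stacked B C = length B ≤ length C × Below C B

-- An entry of the array together with its column.
Cell : Set
Cell = ℕ × ℕ

label : ℕ → List ℕ → List Cell
label c []       = []
label c (x ∷ xs) = (x , c) ∷ label (suc c) xs

cells : List (List ℕ) → List Cell
cells []      = []
cells (B ∷ G) = label 0 B ++ cells G

ColumnRespecting : Cell → Cell → Set
ColumnRespecting p q = proj₁ p < proj₁ q → proj₂ p < proj₂ q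

values-cells : ∀ G → map proj₁ (cells G) ≡ concat G
values-cells []      = refl
values-cells (B ∷ G) = trans (LP.map-++ proj₁ (label 0 B) (cells G)) (cong₂ _++_ (values-label 0 B) (values-cells G))
  where
  values-label : ∀ c xs → map proj₁ (label c xs) ≡ xs
  values-label c []       = refl
  values-label c (x ∷ xs) = cong (x ∷_) (values-label (suc c) xs)

All-label : ∀ {P : Cell → Set} c xs → (∀ i → i < length xs → P (xs ! i , c + i)) → All P (label c xs)
All-label         c []       h = []
All-label {P = P} c (x ∷ xs) h =
  subst (λ z → P (x , z)) (+-identityʳ c) (h 0 (s≤s z≤n)) ∷
  All-label (suc c) xs (λ i p → subst (λ z → P (xs ! i , z)) (+-suc c i) (h (suc i) (s≤s p)))

All-cells : ∀ {P : Cell → Set} G → All (λ C → ∀ d → d < length C → P (C ! d , d)) G → All P (cells G)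
All-cells []      []       = []
All-cells (C ∷ G) (h ∷ hs) = All.++⁺ (All-label 0 C h) (All-cells G hs)

label-respecting : ∀ c xs → AllPairs ColumnRespecting (label c xs)
label-respecting c []       = []
label-respecting c (x ∷ xs) = All-label (suc c) xs (λ i _ _ → s≤s (m≤m+n c i)) ∷ label-respecting (suc c) xs

column-below : ∀ B G c → Linked Stacked (B ∷ G) → c < length B → All (λ C → c < length C × C ! c < B ! c) G
column-below B []      c _                  _ = []
column-below B (C ∷ G) c ((|B|≤|C| , below) ∷ l) p =
  (c<|C| , below c p) ∷ All.map (λ { (q , lt) → q , <-trans lt (below c p) }) (column-below C G c l c<|C|)
  where
  c<|C| : c < length C
  c<|C| = <-≤-trans p |B|≤|C|

-- A cell (B[c], c) of the first row against any cell (C[d], d) of a later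
-- row: if B[c] < C[d] then c < d, since d ≤ c would give C[d] ≤ C[c] < B[c].
first-row-respecting : ∀ B G → Linked Stacked (B ∷ G) → All (Linked _<_) G →
                       All (λ p → All (ColumnRespecting p) (cells G)) (label 0 B)
first-row-respecting B G l ls = All-label 0 B λ c p →
  All-cells G (All.map (λ { ((c<|C| , C[c]<B[c]) , lC) d d<|C| → column-order _ lC d c d<|C| c<|C| C[c]<B[c] })
                       (All.zip (column-below B G c l p , ls)))
  where
  column-order : ∀ C → Linked _<_ C → ∀ d c → d < length C → c < length C →
                 C ! c < B ! c → B ! c < C ! d → c < d
  column-order C lC d c d<|C| c<|C| C[c]<B[c] B[c]<C[d] with c <? d
  ... | yes c<d = c<d
  ... | no c≮d = ⊥-elim (<-asym B[c]<C[d] (≤-<-trans (Linked-!-mono≤ C lC d c (≮⇒≥ c≮d) c<|C|) C[c]<B[c]))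

cells-respecting : ∀ G → All (Linked _<_) G → Linked Stacked G → AllPairs ColumnRespecting (cells G)
cells-respecting []      _          _ = []
cells-respecting (B ∷ G) (_ ∷ ls) l =
  AllPairs.++⁺ (label-respecting 0 B) (cells-respecting G ls (tail l)) (first-row-respecting B G l ls)

cells-columns-bounded : ∀ k G → All (λ B → length B ≤ k) G → All (λ p → proj₂ p < k) (cells G)
cells-columns-bounded k G h = All-cells G (All.map (λ |B|≤k d d<|B| → <-≤-trans d<|B| |B|≤k) h)

lift-sublist : ∀ {s : List ℕ} (zs : List Cell) → s ⊆ map proj₁ zs →
               Σ (List Cell) λ sc → (sc ⊆ zs) × (map proj₁ sc ≡ s)
lift-sublist []       [] = [] , [] , refl
lift-sublist (z ∷ zs) (_ ∷ʳ p) with lift-sublist zs p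
... | sc , q , e = sc , (z ∷ʳ q) , e
lift-sublist (z ∷ zs) (refl ∷ p) with lift-sublist zs p
... | sc , q , e = (z ∷ sc) , (refl ∷ q) , cong (proj₁ z ∷_) e

increasing-columns : ∀ sc → Linked (_<_ on proj₁) sc → AllPairs ColumnRespecting sc → Linked (_<_ on proj₂) sc
increasing-columns []           _          _                 = []
increasing-columns (p ∷ [])     _          _                 = [-]
increasing-columns (p ∷ q ∷ sc) (lt ∷ l) ((resp ∷ _) ∷ rs) = resp lt ∷ increasing-columns (q ∷ sc) l rs

increasing-bounded-length : ∀ k xs → Linked _<_ xs → All (_< k) xs → length xs ≤ k
increasing-bounded-length k []       _ _ = z≤n
increasing-bounded-length k (x ∷ xs) l a = ≤-trans (s≤s (m≤m+n (length xs) x)) (head-bound x xs l a)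
  where
  head-bound : ∀ x xs → Linked _<_ (x ∷ xs) → All (_< k) (x ∷ xs) → length xs + x < k
  head-bound x []       _          (x<k ∷ []) = x<k
  head-bound x (y ∷ ys) (x<y ∷ l) (_ ∷ a)    = begin-strict
    suc (length ys) + x ≡⟨ sym (+-suc (length ys) x) ⟩
    length ys + suc x   ≤⟨ +-monoʳ-≤ (length ys) x<y ⟩
    length ys + y       <⟨ head-bound y ys l a ⟩
    k                   ∎
    where open ≤-Reasoning

increasing-subsequence-bound : ∀ k G → All (Linked _<_) G → Linked Stacked G → All (λ B → length B ≤ k) G →
                               ∀ s → s ⊆ concat G → Linked _<_ s → length s ≤ k
increasing-subsequence-bound k G rows stacked short s sub l
  with lift-sublist (cells G) (subst (s ⊆_) (sym (values-cells G)) sub)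
... | sc , sc⊆cells , refl =
  subst (_≤ k) (sym (LP.length-map proj₁ sc))
    (subst (_≤ k) (LP.length-map proj₂ sc)
      (increasing-bounded-length k (map proj₂ sc)
        (Linked.map⁺ (increasing-columns sc (Linked.map⁻ l) (AllPairs-⊆ sc⊆cells (cells-respecting G rows stacked))))
        (All.map⁺ (Sublist.All-resp-⊆ sc⊆cells (cells-columns-bounded k G short)))))

reverse-replicate : ∀ n (k : ℕ) → reverse (replicate n k) ≡ replicate n k
reverse-replicate zero    k = refl
reverse-replicate (suc n) k = begin
  reverse (k ∷ replicate n k)  ≡⟨ LP.unfold-reverse k (replicate n k) ⟩
  reverse (replicate n k) ++ k ∷ [] ≡⟨ cong (_++ k ∷ []) (reverse-replicate n k) ⟩
  replicate n k ++ k ∷ []      ≡⟨ snoc-replicate n ⟩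
  k ∷ replicate n k            ∎
  where
  open ≡-Reasoning
  snoc-replicate : ∀ n → replicate n k ++ k ∷ [] ≡ k ∷ replicate n k
  snoc-replicate zero    = refl
  snoc-replicate (suc n) = cong (k ∷_) (snoc-replicate n)

sum-shape : ∀ n k r → sum (shape n k r) ≡ n * k + r
sum-shape n k r = trans (sum-++ (replicate n k) (r ∷ [])) (cong₂ _+_ (sum-replicate n) (+-identityʳ r))
  where
  sum-replicate : ∀ n → sum (replicate n k) ≡ n * k
  sum-replicate zero    = refl
  sum-replicate (suc n) = cong (k +_) (sum-replicate n)

shape-reverse : ∀ n k r (G : List (List ℕ)) → map length G ≡ r ∷ replicate n k →
                map length (reverse G) ≡ shape n k r
shape-reverse n k r G e = trans (LP.reverse-map length G)
  (trans (cong reverse e) (trans (LP.unfold-reverse r (replicate n k)) (cong (_++ r ∷ []) (reverse-replicate n k))))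

shape-unreverse : ∀ n k r (T : List (List ℕ)) → map length T ≡ shape n k r →
                  map length (reverse T) ≡ r ∷ replicate n k
shape-unreverse n k r T e = trans (LP.reverse-map length T)
  (trans (cong reverse e) (trans (LP.reverse-++ (replicate n k) (r ∷ [])) (cong (r ∷_) (reverse-replicate n k))))

concat-reverse-↭ : ∀ (G : List (List ℕ)) → concat (reverse G) ↭ concat G
concat-reverse-↭ []      = ↭-refl
concat-reverse-↭ (B ∷ G) rewrite LP.unfold-reverse B G =
  ↭-trans (↭-reflexive (sym (LP.concat-++ (reverse G) (B ∷ []))))
  (↭-trans (Perm.++⁺ʳ (B ++ []) (concat-reverse-↭ G))
  (↭-trans (Perm.++-comm (concat G) (B ++ []))
           (↭-reflexive (cong (_++ concat G) (LP.++-identityʳ B)))))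

length-rows : ∀ n k (Bs : List (List ℕ)) → map length Bs ≡ replicate n k → length Bs ≡ n
length-rows n k Bs e = trans (sym (LP.length-map length Bs)) (trans (cong length e) (LP.length-replicate n))

length-row : ∀ n k (Bs : List (List ℕ)) → map length Bs ≡ replicate n k → ∀ i → i < n → length (rowAt Bs i) ≡ k
length-row (suc n) k (B ∷ Bs) e zero    _       = LP.∷-injectiveˡ e
length-row (suc n) k (B ∷ Bs) e (suc i) (s≤s p) = length-row n k Bs (LP.∷-injectiveʳ e) i p

length-row≤ : ∀ n k (Bs : List (List ℕ)) → map length Bs ≡ replicate n k → ∀ i → length (rowAt Bs i) ≤ k
length-row≤ n k Bs e i with i <? n
... | yes p = ≤-reflexive (length-row n k Bs e i p)
... | no p rewrite rowAt-beyond Bs i (subst (_≤ i) (sym (length-rows n k Bs e)) (≮⇒≥ p)) = z≤n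

!-concat-rows : ∀ n k (Bs : List (List ℕ)) → map length Bs ≡ replicate n k → ∀ i b → i < n → b < k →
                concat Bs ! (i * k + b) ≡ rowAt Bs i ! b
!-concat-rows (suc n) k (B ∷ Bs) e zero    b _       b<k =
  !-++ˡ B (concat Bs) b (subst (b <_) (sym (LP.∷-injectiveˡ e)) b<k)
!-concat-rows (suc n) k (B ∷ Bs) e (suc i) b (s≤s p) b<k = begin
  concat (B ∷ Bs) ! (k + i * k + b)        ≡⟨ cong (concat (B ∷ Bs) !_) (+-assoc k (i * k) b) ⟩
  concat (B ∷ Bs) ! (k + (i * k + b))      ≡⟨ cong (λ m → concat (B ∷ Bs) ! (m + (i * k + b))) (sym (LP.∷-injectiveˡ e)) ⟩
  concat (B ∷ Bs) ! (length B + (i * k + b)) ≡⟨ !-++ʳ B (concat Bs) (i * k + b) ⟩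
  concat Bs ! (i * k + b)                  ≡⟨ !-concat-rows n k Bs (LP.∷-injectiveʳ e) i b p b<k ⟩
  rowAt Bs i ! b                           ∎
  where open ≡-Reasoning

RowsIncrease : List (List ℕ) → Set
RowsIncrease G = ∀ i → Increasing (rowAt G i)

ColumnsDecrease : List (List ℕ) → Set
ColumnsDecrease G = ∀ i → suc i < length G → Below (rowAt G (suc i)) (rowAt G i)

rows⇒All : ∀ {P : List ℕ → Set} G → (∀ i → P (rowAt G i)) → All P G
rows⇒All []      h = []
rows⇒All (B ∷ G) h = h 0 ∷ rows⇒All G (λ i → h (suc i))

adjacent-rows⇒Linked : ∀ {Q : List ℕ → List ℕ → Set} G →
                       (∀ i → suc i < length G → Q (rowAt G i) (rowAt G (suc i))) → Linked Q G
adjacent-rows⇒Linked []          h = []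
adjacent-rows⇒Linked (B ∷ [])    h = [-]
adjacent-rows⇒Linked (B ∷ C ∷ G) h = h 0 (s≤s (s≤s z≤n)) ∷ adjacent-rows⇒Linked (C ∷ G) (λ i p → h (suc i) (s≤s p))

-- The word w = B₀ B₁ ⋯ Bₙ with |B₀| = r and |Bᵢ| = k for i ≥ 1.  Its entries
-- w_{0,b+2} and w_{i+1,b+1} are B₀[b] and B_{i+1}[b]; with these, (L1') says
-- the rows increase, and (L1'), (L2') and avoidance together are equivalent
-- to rows increasing and columns decreasing (given that w is a permutation).
module BlockWord (n k r : ℕ) (B₀ : List ℕ) (Bs : List (List ℕ)) (|B₀| : length B₀ ≡ r)
                 (|Bs| : map length Bs ≡ replicate n k) (1≤n : 1 ≤ n) (r<k : r < k) where

  G : List (List ℕ)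
  G = B₀ ∷ Bs

  w : List ℕ
  w = concat G

  |Bᵢ| : ∀ i → i < n → length (rowAt Bs i) ≡ k
  |Bᵢ| = length-row n k Bs |Bs|

  entry-initial : ∀ b → b < r → entry k r w 0 (suc (suc b)) ≡ B₀ ! b
  entry-initial b b<r = !-++ˡ B₀ (concat Bs) b (subst (b <_) (sym |B₀|) b<r)

  entry-block : ∀ i b → i < n → b < k → entry k r w (suc i) (suc b) ≡ rowAt Bs i ! b
  entry-block i b i<n b<k = begin
    w ! (r + i * k + b)                ≡⟨ cong (w !_) (+-assoc r (i * k) b) ⟩
    w ! (r + (i * k + b))              ≡⟨ cong (λ m → w ! (m + (i * k + b))) (sym |B₀|) ⟩
    w ! (length B₀ + (i * k + b))      ≡⟨ !-++ʳ B₀ (concat Bs) (i * k + b) ⟩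
    concat Bs ! (i * k + b)            ≡⟨ !-concat-rows n k Bs |Bs| i b i<n b<k ⟩
    rowAt Bs i ! b                     ∎
    where open ≡-Reasoning

  suc≤⇒≤∸1 : ∀ {m k} → suc m ≤ k → m ≤ k ∸ 1
  suc≤⇒≤∸1 (s≤s p) = p

  ≤∸1⇒< : ∀ {j k} → 1 ≤ j → j ≤ k ∸ 1 → j < k
  ≤∸1⇒< {suc j} {suc k} _ p = s≤s p

  rows-increase : InL n k r w → RowsIncrease G
  rows-increase (_ , (_ , L1-initial) , _) zero b p =
    let p′ = subst (suc b <_) |B₀| p in
    subst₂ _<_ (entry-initial b (≤-trans (n≤1+n (suc b)) p′)) (entry-initial (suc b) p′)
      (L1-initial (suc (suc b)) (s≤s (s≤s z≤n)) p′)
  rows-increase (_ , (L1-blocks , _) , _) (suc i) b p with i <? n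
  ... | yes i<n =
    let p′ = subst (suc b <_) (|Bᵢ| i i<n) p in
    subst₂ _<_ (entry-block i b i<n (≤-trans (n≤1+n (suc b)) p′)) (entry-block i (suc b) i<n p′)
      (L1-blocks (suc i) (suc b) (s≤s z≤n) i<n (s≤s z≤n) (suc≤⇒≤∸1 p′))
  ... | no i≮n =
    ⊥-elim (1+n≰n (≤-trans (subst (suc b <_) (cong length (rowAt-beyond Bs i
              (subst (_≤ i) (sym (length-rows n k Bs |Bs|)) (≮⇒≥ i≮n)))) p) z≤n))

  -- B₁ lies below B₀ by (L2'); B_{i+2} lies below B_{i+1} by avoidance.
  columns-decrease : InL n k r w → Avoids w (oneTo (suc k)) → ColumnsDecrease G
  columns-decrease (_ , _ , (_ , L2-initial)) _ zero _ b p =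
    let p′ = subst (b <_) |B₀| p in
    subst₂ _<_ (entry-block 0 b 1≤n (<-trans p′ r<k)) (entry-initial b p′) (L2-initial (suc b) (s≤s z≤n) p′)
  columns-decrease inL@(perm , _ , _) avoids (suc i) (s≤s p) b q =
    below-of-avoiding k w (rowAt Bs i) (rowAt Bs (suc i)) b (|Bᵢ| i i<n) (|Bᵢ| (suc i) i+1<n)
      (Increasing⇒Linked _ (rows-increase inL (suc i))) (Increasing⇒Linked _ (rows-increase inL (suc (suc i))))
      (subst (b <_) (|Bᵢ| i i<n) q) (Sublist.++⁺ˡ B₀ (adjacent-rows-⊆ Bs i)) (Unique-perm perm) avoids
    where
    i+1<n : suc i < n
    i+1<n = subst (suc i <_) (length-rows n k Bs |Bs|) p
    i<n : i < n
    i<n = ≤-trans (n≤1+n (suc i)) i+1<n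

  module FromTableau (rows : RowsIncrease G) (columns : ColumnsDecrease G) where

    L1-blocks : ∀ i j → 1 ≤ i → i ≤ n → 1 ≤ j → j ≤ k ∸ 1 → entry k r w i j < entry k r w i (suc j)
    L1-blocks (suc i) (suc b) _ i<n 1≤j j≤k-1 =
      let b+1<k = ≤∸1⇒< 1≤j j≤k-1 in
      subst₂ _<_ (sym (entry-block i b i<n (≤-trans (n≤1+n (suc b)) b+1<k))) (sym (entry-block i (suc b) i<n b+1<k))
        (rows (suc i) b (subst (suc b <_) (sym (|Bᵢ| i i<n)) b+1<k))

    L1-initial : ∀ j → 2 ≤ j → j ≤ r → entry k r w 0 j < entry k r w 0 (suc j)
    L1-initial (suc zero)    (s≤s ()) _
    L1-initial (suc (suc b)) _        p =
      subst₂ _<_ (sym (entry-initial b (≤-trans (n≤1+n (suc b)) p))) (sym (entry-initial (suc b) p))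
        (rows 0 b (subst (suc b <_) (sym |B₀|) p))

    -- w_{i+1,j} < w_{i,j} < w_{i,j+1}: a column step followed by a row step.
    L2-blocks : ∀ i j → 1 ≤ i → i ≤ n ∸ 1 → 1 ≤ j → j ≤ k ∸ 1 → entry k r w (suc i) j < entry k r w i (suc j)
    L2-blocks (suc i) (suc b) 1≤i i≤n-1 1≤j j≤k-1 =
      let i+1<n = ≤∸1⇒< 1≤i i≤n-1 ; i<n = ≤-trans (n≤1+n (suc i)) i+1<n
          b+1<k = ≤∸1⇒< 1≤j j≤k-1 ; b<k = ≤-trans (n≤1+n (suc b)) b+1<k in
      subst₂ _<_ (sym (entry-block (suc i) b i+1<n b<k)) (sym (entry-block i (suc b) i<n b+1<k))
        (<-trans (columns (suc i) (s≤s (subst (suc i <_) (sym (length-rows n k Bs |Bs|)) i+1<n)) b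
                   (subst (b <_) (sym (|Bᵢ| i i<n)) b<k))
                 (rows (suc i) b (subst (suc b <_) (sym (|Bᵢ| i i<n)) b+1<k)))

    L2-initial : ∀ j → 1 ≤ j → j ≤ r → entry k r w 1 j < entry k r w 0 (suc j)
    L2-initial (suc b) _ p =
      subst₂ _<_ (sym (entry-block 0 b 1≤n (<-trans p r<k))) (sym (entry-initial b p))
        (columns 0 (s≤s (subst (0 <_) (sym (length-rows n k Bs |Bs|)) 1≤n)) b (subst (b <_) (sym |B₀|) p))

    stacked : Linked Stacked G
    stacked = adjacent-rows⇒Linked G (λ i p → lengths i p , columns i p)
      where
      lengths : ∀ i → suc i < length G → length (rowAt G i) ≤ length (rowAt G (suc i))
      lengths zero    _       = subst₂ _≤_ (sym |B₀|) (sym (|Bᵢ| 0 1≤n)) (<⇒≤ r<k)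
      lengths (suc i) (s≤s p) =
        let i+1<n = subst (suc i <_) (length-rows n k Bs |Bs|) p in
        ≤-reflexive (trans (|Bᵢ| i (≤-trans (n≤1+n (suc i)) i+1<n)) (sym (|Bᵢ| (suc i) i+1<n)))

    rows-short : ∀ i → length (rowAt G i) ≤ k
    rows-short zero    = subst (_≤ k) (sym |B₀|) (<⇒≤ r<k)
    rows-short (suc i) = length-row≤ n k Bs |Bs| i

    avoids : Avoids w (oneTo (suc k))
    avoids (s , s⊆w , s≅) with ≅oneTo⇒Linked s (suc k) s≅
    ... | increasing , |s| =
      1+n≰n (subst (_≤ k) |s| (increasing-subsequence-bound k G
               (rows⇒All G (λ i → Increasing⇒Linked _ (rows i))) stacked (rows⇒All G rows-short) s s⊆w increasing))

    avoider : IsPerm (n * k + r) w → InLAvoid n k r w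
    avoider perm = (perm , (L1-blocks , L1-initial) , (L2-blocks , L2-initial)) , avoids

conditions-of-avoider : ∀ n k r (G : List (List ℕ)) → map length G ≡ r ∷ replicate n k → 1 ≤ n → r < k →
                        InLAvoid n k r (concat G) → RowsIncrease G × ColumnsDecrease G
conditions-of-avoider n k r (B₀ ∷ Bs) shapeG 1≤n r<k (inL , avoids) = rows-increase inL , columns-decrease inL avoids
  where open BlockWord n k r B₀ Bs (LP.∷-injectiveˡ shapeG) (LP.∷-injectiveʳ shapeG) 1≤n r<k

avoider-of-conditions : ∀ n k r (G : List (List ℕ)) → map length G ≡ r ∷ replicate n k → 1 ≤ n → r < k →
                        RowsIncrease G → ColumnsDecrease G → concat G ↭ oneTo (n * k + r) → InLAvoid n k r (concat G)
avoider-of-conditions n k r (B₀ ∷ Bs) shapeG 1≤n r<k rows columns = avoider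
  where open BlockWord.FromTableau n k r B₀ Bs (LP.∷-injectiveˡ shapeG) (LP.∷-injectiveʳ shapeG) 1≤n r<k rows columns

tableau-of : ℕ → ℕ → ℕ → List ℕ → List (List ℕ)
tableau-of n k r w = reverse (chunks n k r w)

word-of : List (List ℕ) → List ℕ
word-of T = concat (reverse T)

length-perm : ∀ {N w} → IsPerm N w → length w ≡ N
length-perm {N} perm = trans (Perm.↭-length perm) (length-oneTo N)

tableau-of-avoider : ∀ n k r w → 1 ≤ n → r < k → InLAvoid n k r w → IsSYT (shape n k r) (tableau-of n k r w)
tableau-of-avoider n k r w 1≤n r<k avoider@((perm , _) , _) =
  shape-reverse n k r G shapeG ,
  ↭-trans (concat-reverse-↭ G) (subst₂ _↭_ (sym concat-G) (cong oneTo (sym (sum-shape n k r))) perm) ,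
  all-rows-reverse Increasing (λ _ ()) G rows ,
  adjacent-rows-reverse Below (λ _ _ ()) G columns
  where
  G : List (List ℕ)
  G = chunks n k r w
  concat-G : concat G ≡ w
  concat-G = concat-chunks n k r w (length-perm perm)
  shapeG : map length G ≡ r ∷ replicate n k
  shapeG = lengths-chunks n k r w (length-perm perm)
  conditions : RowsIncrease G × ColumnsDecrease G
  conditions = conditions-of-avoider n k r G shapeG 1≤n r<k (subst (InLAvoid n k r) (sym concat-G) avoider)
  rows : RowsIncrease G
  rows = proj₁ conditions
  columns : ColumnsDecrease G
  columns = proj₂ conditions

avoider-of-tableau : ∀ n k r T → 1 ≤ n → r < k → IsSYT (shape n k r) T → InLAvoid n k r (word-of T)
avoider-of-tableau n k r T 1≤n r<k (shapeT , perm , rows , columns) =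
  avoider-of-conditions n k r (reverse T) (shape-unreverse n k r T shapeT) 1≤n r<k
    (all-rows-reverse Increasing (λ _ ()) T rows)
    (λ i p → adjacent-rows-unreverse Below T columns i (subst (suc i <_) (LP.length-reverse T) p))
    (↭-trans (concat-reverse-↭ T) (subst (λ m → concat T ↭ oneTo m) (sum-shape n k r) perm))

proposition6p1 : (n k r : ℕ) → 1 ≤ n → 1 ≤ k → r < k →
    SubsetBij (InLAvoid n k r) (IsSYT (shape n k r))
proposition6p1 n k r 1≤n _ r<k = record
  { to        = λ (w , avoider) → tableau-of n k r w , tableau-of-avoider n k r w 1≤n r<k avoider
  ; from      = λ (T , syt) → word-of T , avoider-of-tableau n k r T 1≤n r<k syt
  ; to-cong   = λ _ _ → cong (tableau-of n k r)
  ; from-cong = λ _ _ → cong word-of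
  ; from∘to   = λ (w , (perm , _) , _) → begin
      concat (reverse (reverse (chunks n k r w))) ≡⟨ cong concat (LP.reverse-involutive (chunks n k r w)) ⟩
      concat (chunks n k r w)                     ≡⟨ concat-chunks n k r w (length-perm perm) ⟩
      w                                           ∎
  ; to∘from   = λ (T , shapeT , _) → begin
      reverse (chunks n k r (concat (reverse T)))
        ≡⟨ cong reverse (chunks-concat n k r (reverse T) (shape-unreverse n k r T shapeT)) ⟩
      reverse (reverse T)                         ≡⟨ LP.reverse-involutive T ⟩
      T                                           ∎
  }
  where open ≡-Reasoning
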